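{- Let $k\ge 2$. Every admissible sequence $\mathbf b=(b_1,\dots,b_{k-1})$ of non-negative integers is a matching sequence.
   Context: Admissible: $\mathbf b$ is admissible if for every choice of distinct integers $a_1,\dots,a_k$ and every choice of sets of integers $M_1,\dots,M_{k-1}$ with $|M_i|=b_i$, there is a permutation $\pi\in S_k$ such that $\sum_{j=1}^{i}a_{\pi(j)}\notin M_i$ for all $i=1,\dots,k-1$. Matching sequence: to $\mathbf b$ associate the bipartite graph $\mathcal B_{\mathbf b}$ with upper class $U=\{(j,l):1\le j\le l\le k-1\}$, lower class $D_{\mathbf b}=\{(i,t):1\le i\le k-1,\ 1\le t\le b_i\}$, and an edge between $(j,l)\in U$ and $(i,t)\in D_{\mathbf b}$ exactly when $j\le i\le l$. The sequence $\mathbf b$ is a matching sequence if $\mathcal B_{\mathbf b}$ has a matching covering all of $D_{\mathbf b}$. -}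

module Defs where

open import Data.Nat using (ℕ; zero; suc; _∸_)
open import Data.Fin using (Fin; zero; suc; _≤_; toℕ)
open import Data.Integer using (ℤ; _+_; 0ℤ)
open import Data.List using (List; length)
open import Data.List.Membership.Propositional using (_∉_)
open import Data.List.Relation.Unary.Unique.Propositional using (Unique)
open import Data.Product using (Σ; _×_; _,_; ∃; ∃-syntax)
open import Data.Fin.Permutation using (Permutation′; _⟨$⟩ʳ_)
open import Function using (_∘_)
open import Function.Definitions using (Injective)
open import Relation.Binary.PropositionalEquality using (_≡_)

sumFirst : ∀ {k} → (Fin k → ℤ) → ℕ → ℤ
sumFirst {zero}  f t       = 0ℤ
sumFirst {suc k} f zero    = 0ℤ
sumFirst {suc k} f (suc t) = f zero + sumFirst (f ∘ suc) t

record FinSetℤ (c : ℕ) : Set where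
  field
    elems  : List ℤ
    unique : Unique elems
    size   : length elems ≡ c
open FinSetℤ public

-- b = (b_1,...,b_{k-1}) is indexed by Fin (k ∸ 1); index i : Fin (k ∸ 1) stands for i+1.
Admissible : (k : ℕ) → (Fin (k ∸ 1) → ℕ) → Set
Admissible k b =
  (a : Fin k → ℤ) → Injective _≡_ _≡_ a →
  (M : (i : Fin (k ∸ 1)) → FinSetℤ (b i)) →
  Σ (Permutation′ k) λ π → (i : Fin (k ∸ 1)) →
      sumFirst (λ j → a (π ⟨$⟩ʳ j)) (suc (toℕ i)) ∉ elems (M i)

-- Bipartite graph B_b: upper class pairs (j,l) with j ≤ l, lower class pairs (i,t) with t < b_i.
Upper : ℕ → Set
Upper k = Σ (Fin (k ∸ 1) × Fin (k ∸ 1)) λ { (j , l) → j ≤ l }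

Lower : (k : ℕ) → (Fin (k ∸ 1) → ℕ) → Set
Lower k b = Σ (Fin (k ∸ 1)) λ i → Fin (b i)

Edge : (k : ℕ) (b : Fin (k ∸ 1) → ℕ) → Upper k → Lower k b → Set
Edge k b ((j , l) , _) (i , _) = (j ≤ i) × (i ≤ l)

MatchingSequence : (k : ℕ) → (Fin (k ∸ 1) → ℕ) → Set
MatchingSequence k b =
  Σ (Lower k b → Upper k) λ f →
    Injective _≡_ _≡_ f × ((d : Lower k b) → Edge k b (f d) d)

-- Picture the upper class as a staircase of cells: the cell at height p of column q (p < q < k)
-- is the vertex (p , q − 1), and row i, of height c = i + 1, may use the cells below height c of
-- the columns q ≥ c. Fill the rows greedily, i = 0, 1, …, each row taking the lowest free cells of
-- the leftmost columns. Columns are filled from the bottom, so rows sharing a column get disjoint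
-- heights, and a greedy run that never runs out of room is a matching.
--
-- It never runs out of room. Let u_i be the column occupation before row i, X_i = Σ_{q ≥ c} u_i q,
-- and T_c = 0 + 1 + ⋯ + (c − 1). Apply admissibility to a = (0, 1, …, k − 1) and
-- M_i = [T_c + X_i , T_c + X_i + b_i). For the permutation σ obtained, σ 0 + ⋯ + σ (c − 1) equals
-- T_c + D_c c, where D_c Q = Σ_{q ≥ Q} w_c q and w_c q is the number of positions p < c with
-- σ q < σ p; so D_c c ∉ [X_i , X_i + b_i). By induction on i the tails of the occupation are
-- dominated, Σ_{q ≥ Q} u_i q ≤ D_i Q, whence X_i ≤ D_c c and so X_i + b_i ≤ D_c c. Had row i run
-- out of room, every column q ≥ c would be full up to height c ≥ w_c q, and the occupation after
-- row i would be both < X_i + b_i and ≥ D_c c.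

module Submission where

open import Data.Nat
open import Data.Nat.Properties
open import Data.Nat.DivMod using (_mod_; m<n⇒m%n≡m)
open import Algebra.Properties.CommutativeSemigroup +-commutativeSemigroup using (interchange)
open import Data.Fin as Fin using (Fin; toℕ)
open import Data.Fin.Properties using (toℕ<n; toℕ-injective; toℕ-fromℕ<)
open import Data.Integer as ℤ using (ℤ)
open import Data.Integer.Properties using (+-injective)
open import Data.List using (map; upTo)
open import Data.List.Properties using (length-map; length-upTo)
open import Data.List.Membership.Propositional using (_∈_; _∉_)
open import Data.List.Membership.Propositional.Properties using (∈-map⁺; ∈-upTo⁺)
open import Data.List.Relation.Unary.Unique.Propositional.Properties using (map⁺; upTo⁺)
open import Data.Product using (∃; _×_; _,_; proj₁; proj₂)
open import Data.Sum using (inj₁; inj₂)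
open import Data.Empty using (⊥-elim)
open import Function using (id; _∘_)
open import Relation.Nullary using (Dec; yes; no; ¬_)
open import Data.Fin.Permutation using (Permutation′; _⟨$⟩ʳ_; _⟨$⟩ˡ_; inverseˡ)
open import Algebra.Properties.CommutativeMonoid.Sum +-0-commutativeMonoid using (sum; sum-permute; sum-cong-≗)
open import Function.Definitions using (Injective)
open import Relation.Binary using (tri<; tri≈; tri>)
open import Relation.Binary.PropositionalEquality
open import Defs

∑< : ℕ → (ℕ → ℕ) → ℕ
∑< zero    f = 0
∑< (suc n) f = ∑< n f + f n

∑<-cong : ∀ n {f g : ℕ → ℕ} → (∀ q → q < n → f q ≡ g q) → ∑< n f ≡ ∑< n g
∑<-cong zero    f≗g = refl
∑<-cong (suc n) f≗g = cong₂ _+_ (∑<-cong n (λ q q<n → f≗g q (m<n⇒m<1+n q<n))) (f≗g n ≤-refl)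

∑<-mono-≤ : ∀ n {f g : ℕ → ℕ} → (∀ q → q < n → f q ≤ g q) → ∑< n f ≤ ∑< n g
∑<-mono-≤ zero    f≤g = z≤n
∑<-mono-≤ (suc n) f≤g = +-mono-≤ (∑<-mono-≤ n (λ q q<n → f≤g q (m<n⇒m<1+n q<n))) (f≤g n ≤-refl)

∑<-monoˡ-≤ : ∀ {m n} (f : ℕ → ℕ) → m ≤ n → ∑< m f ≤ ∑< n f
∑<-monoˡ-≤ {n = zero}  f z≤n = z≤n
∑<-monoˡ-≤ {n = suc n} f m≤1+n with m≤n⇒m<n∨m≡n m≤1+n
... | inj₁ m<1+n = ≤-trans (∑<-monoˡ-≤ f (≤-pred m<1+n)) (m≤m+n (∑< n f) (f n))
... | inj₂ refl  = ≤-refl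

∑<-distrib-+ : ∀ n (f g : ℕ → ℕ) → ∑< n (λ q → f q + g q) ≡ ∑< n f + ∑< n g
∑<-distrib-+ zero    f g = refl
∑<-distrib-+ (suc n) f g =
  trans (cong (_+ (f n + g n)) (∑<-distrib-+ n f g)) (interchange (∑< n f) (∑< n g) (f n) (g n))

∑<-zero : ∀ n → ∑< n (λ _ → 0) ≡ 0
∑<-zero zero    = refl
∑<-zero (suc n) = cong (_+ 0) (∑<-zero n)

∑<-one : ∀ n → ∑< n (λ _ → 1) ≡ n
∑<-one zero    = refl
∑<-one (suc n) = trans (cong (_+ 1) (∑<-one n)) (+-comm n 1)

∑<-comm : ∀ m n (h : ℕ → ℕ → ℕ) → ∑< m (λ p → ∑< n (h p)) ≡ ∑< n (λ q → ∑< m (λ p → h p q))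
∑<-comm zero    n h = sym (∑<-zero n)
∑<-comm (suc m) n h =
  trans (cong (_+ ∑< n (h m)) (∑<-comm m n h)) (sym (∑<-distrib-+ n (λ q → ∑< m (λ p → h p q)) (h m)))

∑<-suc : ∀ n (f : ℕ → ℕ) → ∑< (suc n) f ≡ f 0 + ∑< n (f ∘ suc)
∑<-suc zero    f = +-comm 0 (f 0)
∑<-suc (suc n) f = trans (cong (_+ f (suc n)) (∑<-suc n f)) (+-assoc (f 0) (∑< n (f ∘ suc)) (f (suc n)))

∑<-locate : ∀ m (f : ℕ → ℕ) {t} → t < ∑< m f → ∃ λ q → q < m × ∑< q f ≤ t × t < ∑< (suc q) f
∑<-locate (suc m) f {t} t<∑ with t <? ∑< m f
... | yes t<∑m = let (q , q<m , lo , hi) = ∑<-locate m f t<∑m in q , m<n⇒m<1+n q<m , lo , hi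
... | no  t≮∑m = m , ≤-refl , ≮⇒≥ t≮∑m , t<∑

when : ∀ {P : Set} → Dec P → ℕ → ℕ
when (yes _) x = x
when (no  _) x = 0

module _ {P : Set} where

  when-≤ : ∀ (d : Dec P) x → when d x ≤ x
  when-≤ (yes _) x = ≤-refl
  when-≤ (no  _) x = z≤n

  when-mono : ∀ (d : Dec P) {x y} → (P → x ≤ y) → when d x ≤ when d y
  when-mono (yes p) x≤y = x≤y p
  when-mono (no  _) x≤y = z≤n

  when-yes : ∀ (d : Dec P) {x} → P → when d x ≡ x
  when-yes (yes _) p = refl
  when-yes (no ¬p) p = ⊥-elim (¬p p)

  when-no : ∀ (d : Dec P) {x} → ¬ P → when d x ≡ 0
  when-no (yes p) ¬p = ⊥-elim (¬p p)
  when-no (no  _) ¬p = refl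

  when-≡ : ∀ (d : Dec P) {x} → (¬ P → x ≡ 0) → when d x ≡ x
  when-≡ (yes _) x≡0 = refl
  when-≡ (no ¬p) x≡0 = sym (x≡0 ¬p)

  when-≡0 : ∀ (d : Dec P) {x} → (P → x ≡ 0) → when d x ≡ 0
  when-≡0 (yes p) x≡0 = x≡0 p
  when-≡0 (no  _) x≡0 = refl

  when-pos : ∀ (d : Dec P) {x} → 0 < when d x → P
  when-pos (yes p) pos = p

  when-distrib-+ : ∀ (d : Dec P) x y → when d (x + y) ≡ when d x + when d y
  when-distrib-+ (yes _) x y = refl
  when-distrib-+ (no  _) x y = refl

∑[_,_⟩ : ℕ → ℕ → (ℕ → ℕ) → ℕ
∑[ m , n ⟩ f = ∑< n (λ q → when (m ≤? q) (f q))

∑[0,n⟩≡∑< : ∀ n (f : ℕ → ℕ) → ∑[ 0 , n ⟩ f ≡ ∑< n f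
∑[0,n⟩≡∑< n f = ∑<-cong n (λ q _ → when-yes (0 ≤? q) z≤n)

∑[]-mono-≤ : ∀ m n {f g : ℕ → ℕ} → (∀ q → m ≤ q → q < n → f q ≤ g q) →
             ∑[ m , n ⟩ f ≤ ∑[ m , n ⟩ g
∑[]-mono-≤ m n f≤g = ∑<-mono-≤ n (λ q q<n → when-mono (m ≤? q) (λ m≤q → f≤g q m≤q q<n))

∑[]-distrib-+ : ∀ m n (f g : ℕ → ℕ) → ∑[ m , n ⟩ (λ q → f q + g q) ≡ ∑[ m , n ⟩ f + ∑[ m , n ⟩ g
∑[]-distrib-+ m n f g =
  trans (∑<-cong n (λ q _ → when-distrib-+ (m ≤? q) (f q) (g q))) (∑<-distrib-+ n _ _)

∑[]-zero : ∀ m n (f : ℕ → ℕ) → (∀ q → m ≤ q → q < n → f q ≡ 0) → ∑[ m , n ⟩ f ≡ 0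
∑[]-zero m n f f≡0 =
  trans (∑<-cong n (λ q q<n → when-≡0 (m ≤? q) (λ m≤q → f≡0 q m≤q q<n))) (∑<-zero n)

∑[]-empty : ∀ m (f : ℕ → ℕ) → ∑[ m , m ⟩ f ≡ 0
∑[]-empty m f = ∑[]-zero m m f (λ q m≤q q<m → ⊥-elim (<⇒≱ q<m m≤q))

∑[]-split : ∀ {l m n} (f : ℕ → ℕ) → l ≤ m → m ≤ n →
            ∑[ l , n ⟩ f ≡ ∑[ l , m ⟩ f + ∑[ m , n ⟩ f
∑[]-split {n = zero}    f l≤m z≤n = refl
∑[]-split {l} {m} {suc n} f l≤m m≤1+n with m≤n⇒m<n∨m≡n m≤1+n
... | inj₂ refl  = sym (trans (cong (∑[ l , suc n ⟩ f +_) (∑[]-empty (suc n) f)) (+-identityʳ _))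
... | inj₁ m<1+n = begin
  ∑[ l , n ⟩ f + when (l ≤? n) (f n)
    ≡⟨ cong₂ _+_ (∑[]-split f l≤m m≤n) (when-yes (l ≤? n) (≤-trans l≤m m≤n)) ⟩
  ∑[ l , m ⟩ f + ∑[ m , n ⟩ f + f n
    ≡⟨ +-assoc (∑[ l , m ⟩ f) _ _ ⟩
  ∑[ l , m ⟩ f + (∑[ m , n ⟩ f + f n)
    ≡⟨ cong (λ x → ∑[ l , m ⟩ f + (∑[ m , n ⟩ f + x)) (sym (when-yes (m ≤? n) m≤n)) ⟩
  ∑[ l , m ⟩ f + ∑[ m , suc n ⟩ f ∎
  where
  open ≡-Reasoning
  m≤n = ≤-pred m<1+n

m⊓n+o⊓[m∸n]≡m⊓[n+o] : ∀ m n o → m ⊓ n + o ⊓ (m ∸ n) ≡ m ⊓ (n + o)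
m⊓n+o⊓[m∸n]≡m⊓[n+o] m n o with ≤-total m n
... | inj₁ m≤n = begin
  m ⊓ n + o ⊓ (m ∸ n) ≡⟨ cong₂ _+_ (m≤n⇒m⊓n≡m m≤n) (cong (o ⊓_) (m≤n⇒m∸n≡0 m≤n)) ⟩
  m + o ⊓ 0           ≡⟨ cong (m +_) (⊓-zeroʳ o) ⟩
  m + 0               ≡⟨ +-identityʳ m ⟩
  m                   ≡⟨ sym (m≤n⇒m⊓n≡m (m≤n⇒m≤n+o o m≤n)) ⟩
  m ⊓ (n + o)         ∎
  where open ≡-Reasoning
... | inj₂ n≤m = begin
  m ⊓ n + o ⊓ (m ∸ n)     ≡⟨ cong (_+ o ⊓ (m ∸ n)) (m≥n⇒m⊓n≡n n≤m) ⟩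
  n + o ⊓ (m ∸ n)         ≡⟨ +-distribˡ-⊓ n o (m ∸ n) ⟩
  (n + o) ⊓ (n + (m ∸ n)) ≡⟨ cong ((n + o) ⊓_) (m+[n∸m]≡n n≤m) ⟩
  (n + o) ⊓ m             ≡⟨ ⊓-comm (n + o) m ⟩
  m ⊓ (n + o)             ∎
  where open ≡-Reasoning

-- Column q of a filling state u is occupied at the heights below u q. Filling r cells at height c
-- takes free cells below c from the columns q ≥ c, leftmost column first.
slack : ℕ → (ℕ → ℕ) → ℕ → ℕ
slack c u q = when (c ≤? q) (c ∸ u q)

slackBefore : ℕ → (ℕ → ℕ) → ℕ → ℕ
slackBefore c u q = ∑[ c , q ⟩ (λ p → c ∸ u p)

taken : ℕ → ℕ → (ℕ → ℕ) → ℕ → ℕ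
taken c r u q = slack c u q ⊓ (r ∸ slackBefore c u q)

fill : ℕ → ℕ → (ℕ → ℕ) → ℕ → ℕ
fill c r u q = u q + taken c r u q

slackBefore-mono-≤ : ∀ c u {q q′} → q ≤ q′ → slackBefore c u q ≤ slackBefore c u q′
slackBefore-mono-≤ c u = ∑<-monoˡ-≤ (slack c u)

∑<-taken : ∀ c r u q → ∑< q (taken c r u) ≡ r ⊓ slackBefore c u q
∑<-taken c r u zero    = sym (⊓-zeroʳ r)
∑<-taken c r u (suc q) =
  trans (cong (_+ taken c r u q) (∑<-taken c r u q))
        (m⊓n+o⊓[m∸n]≡m⊓[n+o] r (slackBefore c u q) (slack c u q))

taken-≡0 : ∀ c r u q → r ≤ slackBefore c u q → taken c r u q ≡ 0
taken-≡0 c r u q r≤S = trans (cong (slack c u q ⊓_) (m≤n⇒m∸n≡0 r≤S)) (⊓-zeroʳ (slack c u q))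

taken-≡slack : ∀ c r u q → slackBefore c u (suc q) ≤ r → taken c r u q ≡ slack c u q
taken-≡slack c r u q S≤r =
  m≤n⇒m⊓n≡m (subst (_≤ r ∸ S) (m+n∸m≡n S (slack c u q)) (∸-monoˡ-≤ S S≤r))
  where S = slackBefore c u q

fill-≤ : ∀ c r u q → u q ≤ c → fill c r u q ≤ c
fill-≤ c r u q uq≤c = begin
  u q + taken c r u q ≤⟨ +-monoʳ-≤ (u q) (≤-trans (m⊓n≤m _ _) (when-≤ (c ≤? q) (c ∸ u q))) ⟩
  u q + (c ∸ u q)     ≡⟨ m+[n∸m]≡n uq≤c ⟩
  c                   ∎
  where open ≤-Reasoning

fill-≡ : ∀ c r u q → u q ≤ c → c ≤ q → slackBefore c u (suc q) ≤ r → fill c r u q ≡ c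
fill-≡ c r u q uq≤c c≤q S≤r = begin
  u q + taken c r u q ≡⟨ cong (u q +_) (taken-≡slack c r u q S≤r) ⟩
  u q + slack c u q   ≡⟨ cong (u q +_) (when-yes (c ≤? q) c≤q) ⟩
  u q + (c ∸ u q)     ≡⟨ m+[n∸m]≡n uq≤c ⟩
  c                   ∎
  where open ≡-Reasoning

∑[c,K⟩-fill : ∀ c r u K → ∑[ c , K ⟩ (fill c r u) ≡ ∑[ c , K ⟩ u + r ⊓ slackBefore c u K
∑[c,K⟩-fill c r u K = trans (∑[]-distrib-+ c K u (taken c r u)) (cong (∑[ c , K ⟩ u +_) ∑[c,K⟩-taken)
  where
  taken-below-c : ∀ q → ¬ c ≤ q → taken c r u q ≡ 0
  taken-below-c q c≰q =
    n≤0⇒n≡0 (≤-trans (m⊓n≤m _ _) (≤-reflexive (when-≡0 (c ≤? q) (⊥-elim ∘ c≰q))))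
  ∑[c,K⟩-taken : ∑[ c , K ⟩ (taken c r u) ≡ r ⊓ slackBefore c u K
  ∑[c,K⟩-taken = trans (∑<-cong K (λ q _ → when-≡ (c ≤? q) (taken-below-c q))) (∑<-taken c r u K)

∑[Q,K⟩-fill : ∀ c r u Q K → r ≤ slackBefore c u Q → ∑[ Q , K ⟩ (fill c r u) ≡ ∑[ Q , K ⟩ u
∑[Q,K⟩-fill c r u Q K r≤S = begin
  ∑[ Q , K ⟩ (fill c r u)
    ≡⟨ ∑[]-distrib-+ Q K u (taken c r u) ⟩
  ∑[ Q , K ⟩ u + ∑[ Q , K ⟩ (taken c r u)
    ≡⟨ cong (∑[ Q , K ⟩ u +_) (∑[]-zero Q K (taken c r u) taken-beyond-Q) ⟩
  ∑[ Q , K ⟩ u + 0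
    ≡⟨ +-identityʳ _ ⟩
  ∑[ Q , K ⟩ u ∎
  where
  open ≡-Reasoning
  taken-beyond-Q : ∀ q → Q ≤ q → q < K → taken c r u q ≡ 0
  taken-beyond-Q q Q≤q _ = taken-≡0 c r u q (≤-trans r≤S (slackBefore-mono-≤ c u Q≤q))

record ClaimedCell (K c r : ℕ) (u : ℕ → ℕ) (t : ℕ) : Set where
  field
    column height : ℕ
    c≤column      : c ≤ column
    column<K      : column < K
    u≤height      : u column ≤ height
    height<fill   : height < fill c r u column
    height<c      : height < c
    index         : t ≡ slackBefore c u column + (height ∸ u column)

claimedCell : ∀ K c r u t → (∀ q → u q ≤ c) → t < r → t < slackBefore c u K → ClaimedCell K c r u t
claimedCell K c r u t u≤c t<r t<S with ∑<-locate K (slack c u) t<S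
... | q , q<K , S≤t , t<S+slack = record
  { column      = q
  ; height      = u q + δ
  ; c≤column    = c≤q
  ; column<K    = q<K
  ; u≤height    = m≤m+n (u q) δ
  ; height<fill = +-monoʳ-< (u q) (⊓-glb δ<slack (∸-monoˡ-< t<r S≤t))
  ; height<c    = begin-strict
      u q + δ         <⟨ +-monoʳ-< (u q) δ<slack ⟩
      u q + slack c u q ≡⟨ cong (u q +_) (when-yes (c ≤? q) c≤q) ⟩
      u q + (c ∸ u q) ≡⟨ m+[n∸m]≡n (u≤c q) ⟩
      c               ∎
  ; index       = trans (sym (m+[n∸m]≡n S≤t)) (cong (slackBefore c u q +_) (sym (m+n∸m≡n (u q) δ)))
  }
  where
  open ≤-Reasoning
  δ = t ∸ slackBefore c u q
  δ<slack : δ < slack c u q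
  δ<slack = +-cancelˡ-< (slackBefore c u q) δ _ (subst (_< _) (sym (m+[n∸m]≡n S≤t)) t<S+slack)
  c≤q : c ≤ q
  c≤q = when-pos (c ≤? q) (<-≤-trans (s≤s z≤n) δ<slack)

run : (ℕ → ℕ) → ℕ → ℕ → ℕ
run b zero    = λ _ → 0
run b (suc i) = fill (suc i) (b i) (run b i)

run-≤ : ∀ b i q → run b i q ≤ i
run-≤ b zero    q = z≤n
run-≤ b (suc i) q = fill-≤ (suc i) (b i) (run b i) q (m≤n⇒m≤1+n (run-≤ b i q))

run-mono : ∀ b {i j} q → i ≤ j → run b i q ≤ run b j q
run-mono b {j = zero}  q z≤n = ≤-refl
run-mono b {j = suc j} q i≤1+j with m≤n⇒m<n∨m≡n i≤1+j
... | inj₁ i<1+j = ≤-trans (run-mono b q (≤-pred i<1+j)) (m≤m+n (run b j q) _)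
... | inj₂ refl  = ≤-refl

toℕ-mod : ∀ {q n} .{{_ : NonZero n}} → q < n → toℕ (q mod n) ≡ q
toℕ-mod q<n = trans (toℕ-fromℕ< _) (m<n⇒m%n≡m q<n)

mod-toℕ : ∀ {n} .{{_ : NonZero n}} (j : Fin n) → toℕ j mod n ≡ j
mod-toℕ j = toℕ-injective (toℕ-mod (toℕ<n j))

module RunToMatching (n : ℕ) (b : Fin (suc n) → ℕ) where

  K : ℕ
  K = suc (suc n)

  -- Only the values at i ≤ n matter.
  bℕ : ℕ → ℕ
  bℕ i = b (i mod suc n)

  RunSucceeds : Set
  RunSucceeds = ∀ i → i ≤ n → bℕ i ≤ slackBefore (suc i) (run bℕ i) K

  module _ (succeeds : RunSucceeds) where

    row : Lower K b → ℕ
    row (j , _) = toℕ j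

    cell : (d : Lower K b) → ClaimedCell K (suc (row d)) (bℕ (row d)) (run bℕ (row d)) (toℕ (proj₂ d))
    cell (j , t) = claimedCell K (suc i) (bℕ i) (run bℕ i) (toℕ t)
      (λ q → m≤n⇒m≤1+n (run-≤ bℕ i q)) t<r (≤-trans t<r (succeeds i (≤-pred (toℕ<n j))))
      where
      i = toℕ j
      t<r : toℕ t < bℕ i
      t<r = subst (λ j′ → toℕ t < b j′) (sym (mod-toℕ j)) (toℕ<n t)

    column height : Lower K b → ℕ
    column d = ClaimedCell.column (cell d)
    height d = ClaimedCell.height (cell d)

    height≤row : ∀ d → height d ≤ row d
    height≤row d = ≤-pred (ClaimedCell.height<c (cell d))

    row<column : ∀ d → row d < column d
    row<column d = ClaimedCell.c≤column (cell d)

    toℕ-height : ∀ d → toℕ (height d mod suc n) ≡ height d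
    toℕ-height d@(j , _) = toℕ-mod (s≤s (≤-trans (height≤row d) (≤-pred (toℕ<n j))))

    toℕ-pred-column : ∀ d → toℕ (pred (column d) mod suc n) ≡ pred (column d)
    toℕ-pred-column d = toℕ-mod (s≤s (pred-mono-≤ (≤-pred (ClaimedCell.column<K (cell d)))))

    upper : Lower K b → Upper K
    upper d = (height d mod suc n , pred (column d) mod suc n) ,
      subst₂ _≤_ (sym (toℕ-height d)) (sym (toℕ-pred-column d))
                 (≤-trans (height≤row d) (<⇒≤pred (row<column d)))

    upper-edge : ∀ d → Edge K b (upper d) d
    upper-edge d = subst (_≤ row d) (sym (toℕ-height d)) (height≤row d) ,
                   subst (row d ≤_) (sym (toℕ-pred-column d)) (<⇒≤pred (row<column d))

    earlier-rows-lie-below : ∀ d₁ d₂ → row d₁ < row d₂ → column d₁ ≡ column d₂ →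
                             height d₁ < height d₂
    earlier-rows-lie-below d₁ d₂ r₁<r₂ c₁≡c₂ = begin-strict
      height d₁                         <⟨ ClaimedCell.height<fill (cell d₁) ⟩
      run bℕ (suc (row d₁)) (column d₁) ≤⟨ run-mono bℕ (column d₁) r₁<r₂ ⟩
      run bℕ (row d₂) (column d₁)       ≡⟨ cong (run bℕ (row d₂)) c₁≡c₂ ⟩
      run bℕ (row d₂) (column d₂)       ≤⟨ ClaimedCell.u≤height (cell d₂) ⟩
      height d₂                         ∎
      where open ≤-Reasoning

    same-row-same-cell : ∀ j (t₁ t₂ : Fin (b j)) → column (j , t₁) ≡ column (j , t₂) →
                         height (j , t₁) ≡ height (j , t₂) → t₁ ≡ t₂
    same-row-same-cell j t₁ t₂ c₁≡c₂ h₁≡h₂ = toℕ-injective (begin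
      toℕ t₁
        ≡⟨ ClaimedCell.index (cell (j , t₁)) ⟩
      slackBefore c u q₁ + (height (j , t₁) ∸ u q₁)
        ≡⟨ cong₂ (λ q p → slackBefore c u q + (p ∸ u q)) c₁≡c₂ h₁≡h₂ ⟩
      slackBefore c u q₂ + (height (j , t₂) ∸ u q₂)
        ≡⟨ ClaimedCell.index (cell (j , t₂)) ⟨
      toℕ t₂ ∎)
      where
      open ≡-Reasoning
      c = suc (toℕ j)
      u = run bℕ (toℕ j)
      q₁ = column (j , t₁)
      q₂ = column (j , t₂)

    same-height : ∀ {d₁ d₂} → upper d₁ ≡ upper d₂ → height d₁ ≡ height d₂
    same-height {d₁} {d₂} eq =
      trans (sym (toℕ-height d₁)) (trans (cong (toℕ ∘ proj₁ ∘ proj₁) eq) (toℕ-height d₂))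

    same-column : ∀ {d₁ d₂} → upper d₁ ≡ upper d₂ → column d₁ ≡ column d₂
    same-column {d₁} {d₂} eq = pred-injective {{column-nonZero d₁}} {{column-nonZero d₂}}
      (trans (sym (toℕ-pred-column d₁)) (trans (cong (toℕ ∘ proj₂ ∘ proj₁) eq) (toℕ-pred-column d₂)))
      where
      column-nonZero : ∀ d → NonZero (column d)
      column-nonZero d = >-nonZero (≤-<-trans z≤n (row<column d))

    same-cell⇒same-vertex : ∀ d₁ d₂ → column d₁ ≡ column d₂ → height d₁ ≡ height d₂ → d₁ ≡ d₂
    same-cell⇒same-vertex d₁@(j₁ , t₁) d₂@(j₂ , t₂) c₁≡c₂ h₁≡h₂ with <-cmp (toℕ j₁) (toℕ j₂)
    ... | tri< r₁<r₂ _ _ = ⊥-elim (<-irrefl h₁≡h₂ (earlier-rows-lie-below d₁ d₂ r₁<r₂ c₁≡c₂))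
    ... | tri> _ _ r₂<r₁ = ⊥-elim (<-irrefl (sym h₁≡h₂) (earlier-rows-lie-below d₂ d₁ r₂<r₁ (sym c₁≡c₂)))
    ... | tri≈ _ r₁≡r₂ _ with toℕ-injective r₁≡r₂
    ...   | refl = cong (j₁ ,_) (same-row-same-cell j₁ t₁ t₂ c₁≡c₂ h₁≡h₂)

    upper-injective : Injective _≡_ _≡_ upper
    upper-injective {d₁} {d₂} eq = same-cell⇒same-vertex d₁ d₂ (same-column eq) (same-height eq)

    matching : MatchingSequence K b
    matching = upper , upper-injective , upper-edge

module Domination (K : ℕ) (b : ℕ → ℕ) (w : ℕ → ℕ → ℕ)
                  (w-mono : ∀ i q → w i q ≤ w (suc i) q) (w-≤ : ∀ c q → w c q ≤ c) where

  Dominated : ℕ → Set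
  Dominated i = ∀ Q → i ≤ Q → Q ≤ K → ∑[ Q , K ⟩ (run b i) ≤ ∑[ Q , K ⟩ (w i)

  Avoids : ℕ → Set
  Avoids i = ∑[ suc i , K ⟩ (run b i) ≤ ∑[ suc i , K ⟩ (w (suc i)) →
             ∑[ suc i , K ⟩ (run b i) + b i ≤ ∑[ suc i , K ⟩ (w (suc i))

  module Step (i : ℕ) (c≤K : suc i ≤ K) (dominated : Dominated i) (avoids : Avoids i) where

    c r : ℕ
    c = suc i
    r = b i
    u u′ : ℕ → ℕ
    u  = run b i
    u′ = run b c

    X+r≤D : ∑[ c , K ⟩ u + r ≤ ∑[ c , K ⟩ (w c)
    X+r≤D = avoids (≤-trans (dominated c (n≤1+n i) c≤K) (∑[]-mono-≤ c K (λ q _ _ → w-mono i q)))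

    full-column : ∀ q → c ≤ q → slackBefore c u (suc q) ≤ r → w c q ≤ u′ q
    full-column q c≤q S≤r =
      subst (w c q ≤_) (sym (fill-≡ c r u q (m≤n⇒m≤1+n (run-≤ b i q)) c≤q S≤r)) (w-≤ c q)

    succeeds : r ≤ slackBefore c u K
    succeeds = ≮⇒≥ λ S<r → <-irrefl refl (begin-strict
      ∑[ c , K ⟩ (w c)                  ≤⟨ ∑[]-mono-≤ c K (λ q c≤q q<K → full-column q c≤q
                                              (≤-trans (slackBefore-mono-≤ c u q<K) (<⇒≤ S<r))) ⟩
      ∑[ c , K ⟩ u′                     ≡⟨ ∑[c,K⟩-fill c r u K ⟩
      ∑[ c , K ⟩ u + r ⊓ slackBefore c u K ≡⟨ cong (∑[ c , K ⟩ u +_) (m≥n⇒m⊓n≡n (<⇒≤ S<r)) ⟩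
      ∑[ c , K ⟩ u + slackBefore c u K  <⟨ +-monoʳ-< (∑[ c , K ⟩ u) S<r ⟩
      ∑[ c , K ⟩ u + r                  ≤⟨ X+r≤D ⟩
      ∑[ c , K ⟩ (w c)                  ∎)
      where open ≤-Reasoning

    -- Either row i fits before column Q and leaves the tail from Q untouched, or it fills the
    -- columns c ≤ q < Q, where u′ then dominates w c, so the bound on the tail from c carries over.
    dominated′ : Dominated c
    dominated′ Q c≤Q Q≤K with r ≤? slackBefore c u Q
    ... | yes r≤S = begin
      ∑[ Q , K ⟩ u′    ≡⟨ ∑[Q,K⟩-fill c r u Q K r≤S ⟩
      ∑[ Q , K ⟩ u     ≤⟨ dominated Q (≤-trans (n≤1+n i) c≤Q) Q≤K ⟩
      ∑[ Q , K ⟩ (w i) ≤⟨ ∑[]-mono-≤ Q K (λ q _ _ → w-mono i q) ⟩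
      ∑[ Q , K ⟩ (w c) ∎
      where open ≤-Reasoning
    ... | no r≰S = +-cancelˡ-≤ (∑[ c , Q ⟩ u′) _ _ (begin
      ∑[ c , Q ⟩ u′ + ∑[ Q , K ⟩ u′       ≡⟨ ∑[]-split u′ c≤Q Q≤K ⟨
      ∑[ c , K ⟩ u′                       ≡⟨ ∑[c,K⟩-fill c r u K ⟩
      ∑[ c , K ⟩ u + r ⊓ slackBefore c u K ≡⟨ cong (∑[ c , K ⟩ u +_) (m≤n⇒m⊓n≡m succeeds) ⟩
      ∑[ c , K ⟩ u + r                    ≤⟨ X+r≤D ⟩
      ∑[ c , K ⟩ (w c)                    ≡⟨ ∑[]-split (w c) c≤Q Q≤K ⟩
      ∑[ c , Q ⟩ (w c) + ∑[ Q , K ⟩ (w c) ≤⟨ +-monoˡ-≤ _ (∑[]-mono-≤ c Q columns-before-Q-full) ⟩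
      ∑[ c , Q ⟩ u′ + ∑[ Q , K ⟩ (w c)    ∎)
      where
      open ≤-Reasoning
      columns-before-Q-full : ∀ q → c ≤ q → q < Q → w c q ≤ u′ q
      columns-before-Q-full q c≤q q<Q =
        full-column q c≤q (≤-trans (slackBefore-mono-≤ c u q<Q) (<⇒≤ (≰⇒> r≰S)))

  dominated-upTo : (∀ j → suc j < K → Avoids j) → ∀ i → i < K → Dominated i
  dominated-upTo avoids zero    _     Q _ _ = ∑[]-mono-≤ Q K (λ _ _ _ → z≤n)
  dominated-upTo avoids (suc i) 1+i<K =
    Step.dominated′ i (<⇒≤ 1+i<K) (dominated-upTo avoids i (<-trans (n<1+n i) 1+i<K)) (avoids i 1+i<K)

  run-succeeds : (∀ j → suc j < K → Avoids j) → ∀ i → suc i < K → b i ≤ slackBefore (suc i) (run b i) K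
  run-succeeds avoids i 1+i<K =
    Step.succeeds i (<⇒≤ 1+i<K) (dominated-upTo avoids i (<-trans (n<1+n i) 1+i<K)) (avoids i 1+i<K)

⟦_<_⟧ : ℕ → ℕ → ℕ
⟦ x < y ⟧ = when (x <? y) 1

⟦x<x⟧≡0 : ∀ x → ⟦ x < x ⟧ ≡ 0
⟦x<x⟧≡0 x = when-no (x <? x) (<-irrefl refl)

⟦x<y⟧+⟦y<x⟧≡1 : ∀ {x y} → x ≢ y → ⟦ x < y ⟧ + ⟦ y < x ⟧ ≡ 1
⟦x<y⟧+⟦y<x⟧≡1 {x} {y} x≢y with <-cmp x y
... | tri< x<y _ y≮x = cong₂ _+_ (when-yes (x <? y) x<y) (when-no (y <? x) y≮x)
... | tri≈ _ x≡y _   = ⊥-elim (x≢y x≡y)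
... | tri> x≮y _ y<x = cong₂ _+_ (when-no (x <? y) x≮y) (when-yes (y <? x) y<x)

∑<-⟦<⟧ : ∀ {m v} → v ≤ m → ∑< m (λ y → ⟦ y < v ⟧) ≡ v
∑<-⟦<⟧ {m} {v} v≤m = begin
  ∑< m f                      ≡⟨ ∑[0,n⟩≡∑< m f ⟨
  ∑[ 0 , m ⟩ f                ≡⟨ ∑[]-split f z≤n v≤m ⟩
  ∑[ 0 , v ⟩ f + ∑[ v , m ⟩ f ≡⟨ cong₂ _+_ below-v above-v ⟩
  v + 0                       ≡⟨ +-identityʳ v ⟩
  v                           ∎
  where
  open ≡-Reasoning
  f = λ y → ⟦ y < v ⟧
  below-v : ∑[ 0 , v ⟩ f ≡ v
  below-v = trans (∑[0,n⟩≡∑< v f) (trans (∑<-cong v (λ y y<v → when-yes (y <? v) y<v)) (∑<-one v))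
  above-v : ∑[ v , m ⟩ f ≡ 0
  above-v = ∑[]-zero v m f (λ y v≤y _ → when-no (y <? v) (≤⇒≯ v≤y))

∑<-pairs : ∀ c (σ : ℕ → ℕ) → (∀ p q → p < c → q < c → σ p ≡ σ q → p ≡ q) →
           ∑< c (λ q → ∑< c (λ p → ⟦ σ q < σ p ⟧)) ≡ ∑< c id
∑<-pairs zero    σ σ-inj = refl
∑<-pairs (suc c) σ σ-inj = begin
  ∑< (suc c) (λ q → P q + ⟦ σ q < σ c ⟧)
    ≡⟨ ∑<-distrib-+ (suc c) P (λ q → ⟦ σ q < σ c ⟧) ⟩
  ∑< c P + P c + (∑< c (λ q → ⟦ σ q < σ c ⟧) + ⟦ σ c < σ c ⟧)
    ≡⟨ cong (λ x → ∑< c P + P c + (∑< c (λ q → ⟦ σ q < σ c ⟧) + x)) (⟦x<x⟧≡0 (σ c)) ⟩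
  ∑< c P + P c + (∑< c (λ q → ⟦ σ q < σ c ⟧) + 0)
    ≡⟨ cong (∑< c P + P c +_) (+-identityʳ _) ⟩
  ∑< c P + P c + ∑< c (λ q → ⟦ σ q < σ c ⟧)
    ≡⟨ +-assoc (∑< c P) (P c) _ ⟩
  ∑< c P + (P c + ∑< c (λ q → ⟦ σ q < σ c ⟧))
    ≡⟨ cong₂ _+_ (∑<-pairs c σ (λ p q p<c q<c → σ-inj p q (m<n⇒m<1+n p<c) (m<n⇒m<1+n q<c)))
                 pairs-with-c ⟩
  ∑< c id + c ∎
  where
  open ≡-Reasoning
  P : ℕ → ℕ
  P q = ∑< c (λ p → ⟦ σ q < σ p ⟧)
  pairs-with-c : P c + ∑< c (λ q → ⟦ σ q < σ c ⟧) ≡ c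
  pairs-with-c = begin
    P c + ∑< c (λ q → ⟦ σ q < σ c ⟧)         ≡⟨ ∑<-distrib-+ c _ _ ⟨
    ∑< c (λ p → ⟦ σ c < σ p ⟧ + ⟦ σ p < σ c ⟧) ≡⟨ ∑<-cong c (λ p p<c → ⟦x<y⟧+⟦y<x⟧≡1 (λ σc≡σp →
                                                  <-irrefl (sym (σ-inj c p ≤-refl (m<n⇒m<1+n p<c) σc≡σp)) p<c)) ⟩
    ∑< c (λ _ → 1)                             ≡⟨ ∑<-one c ⟩
    c                                          ∎

∑<≡sum : ∀ n (f : ℕ → ℕ) → ∑< n f ≡ sum {n} (f ∘ toℕ)
∑<≡sum zero    f = refl
∑<≡sum (suc n) f = trans (∑<-suc n f) (cong (f 0 +_) (∑<≡sum n (f ∘ suc)))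

module Ranks {K : ℕ} .{{_ : NonZero K}} (π : Permutation′ K) where

  σ : ℕ → ℕ
  σ q = toℕ (π ⟨$⟩ʳ (q mod K))

  σ-injective : ∀ p q → p < K → q < K → σ p ≡ σ q → p ≡ q
  σ-injective p q p<K q<K σp≡σq = begin
    p                              ≡⟨ toℕ-mod p<K ⟨
    toℕ (p mod K)                  ≡⟨ cong toℕ (inverseˡ π) ⟨
    toℕ (π ⟨$⟩ˡ (π ⟨$⟩ʳ (p mod K))) ≡⟨ cong (toℕ ∘ (π ⟨$⟩ˡ_)) (toℕ-injective σp≡σq) ⟩
    toℕ (π ⟨$⟩ˡ (π ⟨$⟩ʳ (q mod K))) ≡⟨ cong toℕ (inverseˡ π) ⟩
    toℕ (q mod K)                  ≡⟨ toℕ-mod q<K ⟩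
    q                              ∎
    where open ≡-Reasoning

  rank : ∀ v → v ≤ K → ∑< K (λ q → ⟦ σ q < v ⟧) ≡ v
  rank v v≤K = begin
    ∑< K (λ q → ⟦ σ q < v ⟧)                ≡⟨ ∑<≡sum K _ ⟩
    sum {K} (λ j → ⟦ σ (toℕ j) < v ⟧)      ≡⟨ sum-cong-≗ (cong (λ x → ⟦ toℕ (π ⟨$⟩ʳ x) < v ⟧) ∘ mod-toℕ) ⟩
    sum {K} (λ j → ⟦ toℕ (π ⟨$⟩ʳ j) < v ⟧)  ≡⟨ sum-permute (λ y → ⟦ toℕ y < v ⟧) π ⟨
    sum {K} (λ y → ⟦ toℕ y < v ⟧)           ≡⟨ ∑<≡sum K _ ⟨
    ∑< K (λ y → ⟦ y < v ⟧)                  ≡⟨ ∑<-⟦<⟧ v≤K ⟩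
    v                                       ∎
    where open ≡-Reasoning

  w : ℕ → ℕ → ℕ
  w c q = ∑< c (λ p → ⟦ σ q < σ p ⟧)

  w-mono : ∀ c q → w c q ≤ w (suc c) q
  w-mono c q = m≤m+n (w c q) _

  w-≤ : ∀ c q → w c q ≤ c
  w-≤ c q = subst (w c q ≤_) (∑<-one c) (∑<-mono-≤ c (λ p _ → when-≤ (σ q <? σ p) 1))

  -- Both sides count the pairs (q , p) with p < c and σ q < σ p, the right one split by q < c.
  ∑<-σ : ∀ c → c ≤ K → ∑< c σ ≡ ∑< c id + ∑[ c , K ⟩ (w c)
  ∑<-σ c c≤K = begin
    ∑< c σ                               ≡⟨ ∑<-cong c (λ p _ → sym (rank (σ p) (<⇒≤ (toℕ<n _)))) ⟩
    ∑< c (λ p → ∑< K (λ q → ⟦ σ q < σ p ⟧)) ≡⟨ ∑<-comm c K _ ⟩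
    ∑< K (w c)                           ≡⟨ ∑[0,n⟩≡∑< K (w c) ⟨
    ∑[ 0 , K ⟩ (w c)                     ≡⟨ ∑[]-split (w c) z≤n c≤K ⟩
    ∑[ 0 , c ⟩ (w c) + ∑[ c , K ⟩ (w c)  ≡⟨ cong (_+ ∑[ c , K ⟩ (w c)) (∑[0,n⟩≡∑< c (w c)) ⟩
    ∑< c (w c) + ∑[ c , K ⟩ (w c)        ≡⟨ cong (_+ ∑[ c , K ⟩ (w c)) (∑<-pairs c σ σ-inj) ⟩
    ∑< c id + ∑[ c , K ⟩ (w c)           ∎
    where
    open ≡-Reasoning
    σ-inj : ∀ p q → p < c → q < c → σ p ≡ σ q → p ≡ q
    σ-inj p q p<c q<c = σ-injective p q (<-≤-trans p<c c≤K) (<-≤-trans q<c c≤K)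

sumFirst≡∑< : ∀ {k} (f : Fin k → ℤ) (g : ℕ → ℕ) → (∀ x → f x ≡ ℤ.+ g (toℕ x)) →
              ∀ {t} → t ≤ k → sumFirst f t ≡ ℤ.+ ∑< t g
sumFirst≡∑< {zero}  f g f≡g {zero}  _         = refl
sumFirst≡∑< {suc k} f g f≡g {zero}  _         = refl
sumFirst≡∑< {suc k} f g f≡g {suc t} (s≤s t≤k) =
  trans (cong₂ ℤ._+_ (f≡g Fin.zero) (sumFirst≡∑< (f ∘ Fin.suc) (g ∘ suc) (f≡g ∘ Fin.suc) t≤k))
        (cong ℤ.+_ (sym (∑<-suc t g)))

intervalℤ : (base r : ℕ) → FinSetℤ r
intervalℤ base r = record
  { elems  = map (λ t → ℤ.+ (base + t)) (upTo r)
  ; unique = map⁺ (λ eq → +-cancelˡ-≡ base _ _ (+-injective eq)) (upTo⁺ r)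
  ; size   = trans (length-map _ (upTo r)) (length-upTo r)
  }

∉-intervalℤ : ∀ base r x → base ≤ x → ℤ.+ x ∉ elems (intervalℤ base r) → base + r ≤ x
∉-intervalℤ base r x base≤x x∉ = ≮⇒≥ (x∉ ∘ x∈)
  where
  x∈ : x < base + r → ℤ.+ x ∈ elems (intervalℤ base r)
  x∈ x<base+r = subst (λ y → ℤ.+ y ∈ elems (intervalℤ base r)) (m+[n∸m]≡n base≤x)
    (∈-map⁺ (λ t → ℤ.+ (base + t)) (∈-upTo⁺ (+-cancelˡ-< base _ r
      (subst (_< base + r) (sym (m+[n∸m]≡n base≤x)) x<base+r))))

module AdmissibleToMatching (n : ℕ) (b : Fin (suc n) → ℕ) where
  open RunToMatching n b

  offset : ℕ → ℕ
  offset i = ∑< (suc i) id + ∑[ suc i , K ⟩ (run bℕ i)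

  forbidden : (j : Fin (suc n)) → FinSetℤ (b j)
  forbidden j = intervalℤ (offset (toℕ j)) (b j)

  position : Fin K → ℤ
  position x = ℤ.+ toℕ x

  position-injective : Injective _≡_ _≡_ position
  position-injective eq = toℕ-injective (+-injective eq)

  module _ (π : Permutation′ K) where
    open Ranks π
    open Domination K bℕ w w-mono w-≤

    NotForbidden : ℕ → ℕ → Set
    NotForbidden i r = sumFirst (position ∘ (π ⟨$⟩ʳ_)) (suc i) ∉ elems (intervalℤ (offset i) r)

    sumFirst-π : ∀ i → i ≤ n →
      sumFirst (position ∘ (π ⟨$⟩ʳ_)) (suc i) ≡ ℤ.+ (∑< (suc i) id + ∑[ suc i , K ⟩ (w (suc i)))
    sumFirst-π i i≤n = trans
      (sumFirst≡∑< _ σ (λ x → cong (position ∘ (π ⟨$⟩ʳ_)) (sym (mod-toℕ x))) (s≤s (m≤n⇒m≤1+n i≤n)))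
      (cong ℤ.+_ (∑<-σ (suc i) (s≤s (m≤n⇒m≤1+n i≤n))))

    avoids : ∀ i → i ≤ n → NotForbidden i (bℕ i) → Avoids i
    avoids i i≤n not-forbidden X≤D = +-cancelˡ-≤ (∑< c id) _ _ (begin
      ∑< c id + (X + bℕ i) ≡⟨ +-assoc (∑< c id) X (bℕ i) ⟨
      offset i + bℕ i      ≤⟨ ∉-intervalℤ (offset i) (bℕ i) _ (+-monoʳ-≤ (∑< c id) X≤D)
                                (subst (_∉ _) (sumFirst-π i i≤n) not-forbidden) ⟩
      ∑< c id + D          ∎)
      where
      open ≤-Reasoning
      c = suc i
      X = ∑[ c , K ⟩ (run bℕ i)
      D = ∑[ c , K ⟩ (w c)

    module _ (avoiding : ∀ j → NotForbidden (toℕ j) (b j)) where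

      avoiding-ℕ : ∀ i → i ≤ n → NotForbidden i (bℕ i)
      avoiding-ℕ i i≤n =
        subst (λ i′ → NotForbidden i′ (bℕ i)) (toℕ-mod (s≤s i≤n)) (avoiding (i mod suc n))

      succeeds : RunSucceeds
      succeeds i i≤n = run-succeeds avoids′ i (s≤s (s≤s i≤n))
        where
        avoids′ : ∀ i → suc i < K → Avoids i
        avoids′ i (s≤s (s≤s i≤n)) = avoids i i≤n (avoiding-ℕ i i≤n)

  admissible⇒matching : Admissible K b → MatchingSequence K b
  admissible⇒matching admissible with admissible position position-injective forbidden
  ... | π , avoiding = matching (succeeds π avoiding)

proposition5p7 : (k : ℕ) → 2 ≤ k → (b : Fin (k ∸ 1) → ℕ) →
    Admissible k b → MatchingSequence k b
proposition5p7 (suc zero)    (s≤s ())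
proposition5p7 (suc (suc n)) _ = AdmissibleToMatching.admissible⇒matching n
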